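{- For every integer $k\ge 1$, $\chi_{la}(kD(8,2))=3$.
   Context: For a graph $G=(V,E)$ with $|E|=m$ and no isolated vertices, a local antimagic labeling is a bijection $f:E\to\{1,\dots,m\}$ such that $f^+(u)\ne f^+(v)$ for every edge $uv$, where $f^+(x)=\sum f(e)$ over all edges $e$ incident to $x$. The local antimagic chromatic number $\chi_{la}(G)$ is the minimum, over all local antimagic labelings $f$ of $G$, of the number of distinct values taken by $f^+$ (also for disconnected graphs). $kG$ is the disjoint union of $k$ copies of $G$. Let $C_8^*$ be the graph consisting of an 8-cycle $u_1u_2\cdots u_8u_1$ together with an additional vertex $x$ adjacent to $u_2$ and $u_6$. $D(8,2)$ is obtained from $C_8^*$ by merging the three vertices $x$, $u_4$, $u_8$ into a single vertex $w$ (of degree 6). -}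

module Defs where

open import Data.Nat using (ℕ; zero; suc; _+_; _*_; _≤_)
open import Data.Nat.Properties using (_≟_)
open import Data.Fin as F using (Fin; toℕ; combine; remQuot; #_)
open import Data.Fin.Properties using () renaming (_≟_ to _≟ᶠ_)
open import Data.Product using (_×_; _,_; proj₁; proj₂; Σ; ∃)
open import Data.Sum using (_⊎_)
open import Data.Nat.ListAction using (sum)
open import Data.List using (List; map; length; deduplicate; allFin)
open import Data.Vec using (Vec; lookup; []; _∷_)
open import Data.Bool using (if_then_else_)
open import Relation.Nullary using (¬_; _⊎-dec_)
open import Relation.Nullary.Decidable using (⌊_⌋)
open import Relation.Binary.PropositionalEquality using (_≡_)
open import Function.Definitions using (Bijective)

record Graph : Set where
  field
    nV : ℕ
    nE : ℕ
    ends : Fin nE → Fin nV × Fin nV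
open Graph public

Labeling : Graph → Set
Labeling G = Σ (Fin (nE G) → Fin (nE G)) (Bijective _≡_ _≡_)

label : (G : Graph) → Labeling G → Fin (nE G) → ℕ
label G (f , _) e = suc (toℕ (f e))

vsum : (G : Graph) → Labeling G → Fin (nV G) → ℕ
vsum G f v = sum (map (λ e → if ⌊ (proj₁ (ends G e) ≟ᶠ v) ⊎-dec (proj₂ (ends G e) ≟ᶠ v) ⌋
                               then label G f e else 0)
                      (allFin (nE G)))

IsLocalAntimagic : (G : Graph) → Labeling G → Set
IsLocalAntimagic G f = ∀ e → ¬ (vsum G f (proj₁ (ends G e)) ≡ vsum G f (proj₂ (ends G e)))

numColors : (G : Graph) → Labeling G → ℕ
numColors G f = length (deduplicate _≟_ (map (vsum G f) (allFin (nV G))))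

ChiLaEq : Graph → ℕ → Set
ChiLaEq G c =
  (∃ λ (f : Labeling G) → IsLocalAntimagic G f × numColors G f ≡ c)
  × (∀ (f : Labeling G) → IsLocalAntimagic G f → c ≤ numColors G f)

copies : ℕ → Graph → Graph
copies k G = record
  { nV = k * nV G
  ; nE = k * nE G
  ; ends = λ x → let i = proj₁ (remQuot {k} (nE G) x)
                     e = proj₂ (remQuot {k} (nE G) x)
                 in combine {k} {nV G} i (proj₁ (ends G e)) , combine {k} {nV G} i (proj₂ (ends G e))
  }

-- D(8,2): vertices 0=u1, 1=u2, 2=u3, 3=u5, 4=u6, 5=u7, 6=w (w = x = u4 = u8 merged)
D82edges : Vec (Fin 7 × Fin 7) 10
D82edges =
  (# 0 , # 1) ∷ (# 1 , # 2) ∷ (# 2 , # 6) ∷ (# 6 , # 3) ∷ (# 3 , # 4) ∷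
  (# 4 , # 5) ∷ (# 5 , # 6) ∷ (# 6 , # 0) ∷ (# 6 , # 1) ∷ (# 6 , # 4) ∷ []

D82 : Graph
D82 = record { nV = 7 ; nE = 10 ; ends = lookup D82edges }

module Submission where

-- The vertices u₁, u₂, w span a triangle, so any local antimagic labelling of kD(8,2) needs at least
-- three vertex sums. For the upper bound, cut the labels 1, …, 10k into five blocks of 2k consecutive
-- labels and pair the ten edges of D(8,2), one pair per block. In the copy with index a (and o = k − 1 − a)
-- a pair receives the positions {a, k + o}, {2a, 2a + 1} or {2o, 2o + 1} of its block. These are arranged
-- so that a and o enter every vertex sum only through a + o = k − 1, which makes the vertex sums
-- independent of the copy: 8k + 1 at vertices of degree 2, 14k + 1 at u₂ and u₆, and 40k + 4 at w.

open import Defs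
open import Data.Bool using (false; if_then_else_)
open import Data.Fin as Fin using (Fin; zero; suc; toℕ; combine; remQuot; cast; opposite; _↑ˡ_; _↑ʳ_)
open import Data.Fin.Patterns using (0F; 1F; 2F; 3F; 4F; 5F; 6F; 7F; 8F; 9F)
open import Data.Fin.Properties as Finₚ
  using ( _≟_; all?; *↔×; injective⇒≤; remQuot-combine; combine-remQuot; combine-injective
        ; cast-involutive; toℕ-cast; toℕ-combine; toℕ<n; opposite-prop; opposite-involutive )
open import Data.List using (List; []; _∷_; tabulate; lookup; length; map; allFin; deduplicate)
open import Data.List.Properties using (map-tabulate; tabulate-cong; length-map)
open import Data.List.Membership.Propositional using (_∈_)
open import Data.List.Membership.Propositional.Properties
  using (∈-lookup; ∈-map⁺; ∈-map⁻; ∈-allFin; ∈-deduplicate⁺; ∈-deduplicate⁻)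
open import Data.List.Relation.Binary.Subset.Propositional using (_⊆_)
open import Data.List.Relation.Unary.All as All using ([]; _∷_)
open import Data.List.Relation.Unary.AllPairs using ([]; _∷_)
open import Data.List.Relation.Unary.Any using (index)
open import Data.List.Relation.Unary.Any.Properties using (lookup-index)
open import Data.List.Relation.Unary.Unique.Propositional using (Unique)
open import Data.Nat as ℕ using (ℕ; _+_; _*_; _∸_; _≤_; _<_; _<?_; NonZero)
import Data.Nat.Properties as ℕₚ
open import Data.Nat.Properties
  using ( +-assoc; +-identityʳ; *-comm; *-assoc; m+[n∸m]≡n; <⇒≢; <-trans
        ; +-monoˡ-<; +-mono-<; *-monoˡ-<; ≤-antisym )
open import Data.List.Relation.Unary.Unique.DecPropositional.Properties ℕₚ._≟_ using (deduplicate-!)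
open import Data.Nat.ListAction using (sum)
open import Data.Nat.Tactic.RingSolver using (solve-∀)
open import Data.Product as Product using (_×_; _,_; proj₁; proj₂; ∃-syntax; uncurry)
open import Data.Product.Properties using (≡-dec)
open import Data.Sum as Sum using (_⊎_; inj₁; inj₂)
open import Function using (_∘_; _⇔_; mk⇔; Equivalence; _↔_; mk↔ₛ′; Inverse; Bijection; Injective)
open import Function.Properties.Inverse using (↔-sym; ↔-trans; ↔⇒⤖)
open import Function.Related.Propositional using (module EquationalReasoning)
open import Function.Related.TypeIsomorphisms using (×-comm)
open import Relation.Binary.PropositionalEquality
open import Relation.Nullary using (Dec; ¬?; _⊎-dec_; contradiction)
open import Relation.Nullary.Decidable using (⌊_⌋; from-yes; isYes≗does; does-⇔; dec-false)

⌊⌋-⇔ : ∀ {A B : Set} → A ⇔ B → (a? : Dec A) (b? : Dec B) → ⌊ a? ⌋ ≡ ⌊ b? ⌋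
⌊⌋-⇔ A⇔B a? b? = trans (isYes≗does a?) (trans (does-⇔ A⇔B a? b?) (sym (isYes≗does b?)))

sum-tabulate-↑ : ∀ m n (g : Fin (m + n) → ℕ) →
                 sum (tabulate g)
                 ≡ sum (tabulate λ (i : Fin m) → g (i ↑ˡ n)) + sum (tabulate λ j → g (m ↑ʳ j))
sum-tabulate-↑ ℕ.zero    n g = refl
sum-tabulate-↑ (ℕ.suc m) n g =
  trans (cong (g zero +_) (sum-tabulate-↑ m n λ i → g (suc i))) (sym (+-assoc (g zero) _ _))

sum-tabulate-combine : ∀ k m (g : Fin (k * m) → ℕ) →
                       sum (tabulate g)
                       ≡ sum (tabulate λ (i : Fin k) → sum (tabulate λ (j : Fin m) → g (combine i j)))
sum-tabulate-combine ℕ.zero    m g = refl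
sum-tabulate-combine (ℕ.suc k) m g =
  trans (sum-tabulate-↑ m (k * m) g)
        (cong (sum (tabulate λ j → g (j ↑ˡ k * m)) +_) (sum-tabulate-combine k m λ i → g (m ↑ʳ i)))

sum-tabulate-zero : ∀ {n} {g : Fin n → ℕ} → (∀ i → g i ≡ 0) → sum (tabulate g) ≡ 0
sum-tabulate-zero {ℕ.zero}  g≡0 = refl
sum-tabulate-zero {ℕ.suc n} g≡0 = cong₂ _+_ (g≡0 zero) (sum-tabulate-zero (g≡0 ∘ suc))

sum-tabulate-single : ∀ {n} {g : Fin n → ℕ} (i : Fin n) → (∀ j → j ≢ i → g j ≡ 0) →
                      sum (tabulate g) ≡ g i
sum-tabulate-single {g = g} zero g≡0 =
  trans (cong (g zero +_) (sum-tabulate-zero λ j → g≡0 (suc j) λ ())) (+-identityʳ (g zero))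
sum-tabulate-single (suc i) g≡0 =
  cong₂ _+_ (g≡0 zero λ ()) (sum-tabulate-single i λ j j≢i → g≡0 (suc j) (j≢i ∘ Finₚ.suc-injective))

lookup-injective : ∀ {A : Set} {xs : List A} → Unique xs → Injective _≡_ _≡_ (lookup xs)
lookup-injective (_  ∷ _)  {zero}  {zero}  _  = refl
lookup-injective (x∉ ∷ _)  {zero}  {suc j} eq = contradiction eq (All.lookup x∉ (∈-lookup j))
lookup-injective (x∉ ∷ _)  {suc i} {zero}  eq = contradiction (sym eq) (All.lookup x∉ (∈-lookup i))
lookup-injective (_  ∷ u)  {suc i} {suc j} eq = cong suc (lookup-injective u eq)

Unique∧⊆⇒length≤ : ∀ {A : Set} {xs ys : List A} → Unique xs → xs ⊆ ys → length xs ≤ length ys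
Unique∧⊆⇒length≤ {xs = xs} {ys} xs! xs⊆ys = injective⇒≤ {f = position} position-injective
  where
  position : Fin (length xs) → Fin (length ys)
  position i = index (xs⊆ys (∈-lookup i))
  position-injective : Injective _≡_ _≡_ position
  position-injective {i} {j} eq = lookup-injective xs! (begin
    lookup xs i             ≡⟨ lookup-index (xs⊆ys (∈-lookup i)) ⟩
    lookup ys (position i)  ≡⟨ cong (lookup ys) eq ⟩
    lookup ys (position j)  ≡⟨ lookup-index (xs⊆ys (∈-lookup j)) ⟨
    lookup xs j             ∎)
    where open ≡-Reasoning

Incident : (G : Graph) → Fin (nV G) → Fin (nE G) → Set
Incident G v e = proj₁ (ends G e) ≡ v ⊎ proj₂ (ends G e) ≡ v

incident? : (G : Graph) (v : Fin (nV G)) (e : Fin (nE G)) → Dec (Incident G v e)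
incident? G v e = (proj₁ (ends G e) ≟ v) ⊎-dec (proj₂ (ends G e) ≟ v)

incidenceSum : (G : Graph) → (Fin (nE G) → ℕ) → Fin (nV G) → ℕ
incidenceSum G w v = sum (tabulate λ e → if ⌊ incident? G v e ⌋ then w e else 0)

incidenceSum-cong : ∀ G {w w′ : Fin (nE G) → ℕ} → (∀ e → w e ≡ w′ e) → ∀ v →
                    incidenceSum G w v ≡ incidenceSum G w′ v
incidenceSum-cong G w≡w′ v =
  cong sum (tabulate-cong λ e → cong (if ⌊ incident? G v e ⌋ then_else 0) (w≡w′ e))

vsum≡incidenceSum : ∀ G f v → vsum G f v ≡ incidenceSum G (label G f) v
vsum≡incidenceSum G f v = cong sum (map-tabulate {n = nE G} (λ e → e) _)

ProperColouring : (G : Graph) {A : Set} → (Fin (nV G) → A) → Set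
ProperColouring G c = ∀ e → c (proj₁ (ends G e)) ≢ c (proj₂ (ends G e))

Adjacent : (G : Graph) → Fin (nV G) → Fin (nV G) → Set
Adjacent G x y = ∃[ e ] (ends G e ≡ (x , y) ⊎ ends G e ≡ (y , x))

adjacent⇒≢ : ∀ G {A : Set} {c : Fin (nV G) → A} {x y} → ProperColouring G c → Adjacent G x y → c x ≢ c y
adjacent⇒≢ G {c = c} proper (e , inj₁ ends≡) eq =
  proper e (subst (λ (x , y) → c x ≡ c y) (sym ends≡) eq)
adjacent⇒≢ G {c = c} proper (e , inj₂ ends≡) eq =
  proper e (subst (λ (y , x) → c y ≡ c x) (sym ends≡) (sym eq))

colours : (G : Graph) → Labeling G → List ℕ
colours G f = deduplicate ℕₚ._≟_ (map (vsum G f) (allFin (nV G)))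

numColors≤length : ∀ G f {cs : List ℕ} → (∀ v → vsum G f v ∈ cs) → numColors G f ≤ length cs
numColors≤length G f {cs} vsum∈cs = Unique∧⊆⇒length≤ (deduplicate-! _) colours⊆cs
  where
  colours⊆cs : colours G f ⊆ cs
  colours⊆cs c∈ with v , _ , refl ← ∈-map⁻ (vsum G f) (∈-deduplicate⁻ ℕₚ._≟_ _ c∈) = vsum∈cs v

length≤numColors : ∀ G f (vs : List (Fin (nV G))) → Unique (map (vsum G f) vs) → length vs ≤ numColors G f
length≤numColors G f vs vsums! =
  subst (_≤ numColors G f) (length-map (vsum G f) vs) (Unique∧⊆⇒length≤ vsums! vsums⊆colours)
  where
  vsums⊆colours : map (vsum G f) vs ⊆ colours G f
  vsums⊆colours c∈ with v , _ , refl ← ∈-map⁻ (vsum G f) c∈ =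
    ∈-deduplicate⁺ ℕₚ._≟_ (∈-map⁺ (vsum G f) (∈-allFin v))

triangle⇒3≤numColors : ∀ G f {x y z} → IsLocalAntimagic G f →
                       Adjacent G x y → Adjacent G y z → Adjacent G x z → 3 ≤ numColors G f
triangle⇒3≤numColors G f {x} {y} {z} antimagic xy yz xz =
  length≤numColors G f (x ∷ y ∷ z ∷ []) ((x≢y ∷ x≢z ∷ []) ∷ (y≢z ∷ []) ∷ [] ∷ [])
  where
  x≢y = adjacent⇒≢ G antimagic xy
  y≢z = adjacent⇒≢ G antimagic yz
  x≢z = adjacent⇒≢ G antimagic xz

ends-copies : ∀ k G (i : Fin k) e →
              ends (copies k G) (combine i e) ≡ Product.map (combine i) (combine i) (ends G e)
ends-copies k G i e = cong (λ (j , e′) → Product.map (combine j) (combine j) (ends G e′)) (remQuot-combine i e)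

adjacent-copies : ∀ k G (i : Fin k) {x y} → Adjacent G x y → Adjacent (copies k G) (combine i x) (combine i y)
adjacent-copies k G i (e , ends≡) = combine i e , Sum.map in-copy in-copy ends≡
  where
  in-copy : ∀ {p} → ends G e ≡ p → ends (copies k G) (combine i e) ≡ Product.map (combine i) (combine i) p
  in-copy eq = trans (ends-copies k G i e) (cong (Product.map (combine i) (combine i)) eq)

incident-copies : ∀ k G (i j : Fin k) v e →
                  Incident (copies k G) (combine i v) (combine j e) ⇔ (j ≡ i × Incident G v e)
incident-copies k G i j v e =
  subst (λ (a , b) → (a ≡ combine i v ⊎ b ≡ combine i v) ⇔ (j ≡ i × Incident G v e))
        (sym (ends-copies k G j e)) (mk⇔ to from)
  where
  to : combine j (proj₁ (ends G e)) ≡ combine i v ⊎ combine j (proj₂ (ends G e)) ≡ combine i v →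
       j ≡ i × Incident G v e
  to (inj₁ eq) = Product.map₂ inj₁ (combine-injective j _ i v eq)
  to (inj₂ eq) = Product.map₂ inj₂ (combine-injective j _ i v eq)
  from : j ≡ i × Incident G v e →
         combine j (proj₁ (ends G e)) ≡ combine i v ⊎ combine j (proj₂ (ends G e)) ≡ combine i v
  from (refl , inc) = Sum.map (cong (combine i)) (cong (combine i)) inc

vsum-copies : ∀ k G f (i : Fin k) v →
              vsum (copies k G) f (combine i v) ≡ incidenceSum G (λ e → label (copies k G) f (combine i e)) v
vsum-copies k G f i v = begin
  vsum H f (combine i v)                            ≡⟨ vsum≡incidenceSum H f (combine i v) ⟩
  sum (tabulate summand)                            ≡⟨ sum-tabulate-combine k (nE G) summand ⟩
  sum (tabulate copySum)                            ≡⟨ sum-tabulate-single i other-copy ⟩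
  copySum i                                         ≡⟨ cong sum (tabulate-cong same-copy) ⟩
  incidenceSum G (λ e → label H f (combine i e)) v  ∎
  where
  open ≡-Reasoning
  H = copies k G
  summand : Fin (k * nE G) → ℕ
  summand x = if ⌊ incident? H (combine i v) x ⌋ then label H f x else 0
  copySum : Fin k → ℕ
  copySum j = sum (tabulate λ e → summand (combine j e))
  other-copy : ∀ j → j ≢ i → copySum j ≡ 0
  other-copy j j≢i = sum-tabulate-zero λ e → cong (if_then label H f (combine j e) else 0) (not-incident e)
    where
    not-incident : ∀ e → ⌊ incident? H (combine i v) (combine j e) ⌋ ≡ false
    not-incident e = trans (isYes≗does incident)
                           (dec-false incident (j≢i ∘ proj₁ ∘ Equivalence.to (incident-copies k G i j v e)))
      where incident = incident? H (combine i v) (combine j e)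
  same-copy : ∀ e → summand (combine i e) ≡ (if ⌊ incident? G v e ⌋ then label H f (combine i e) else 0)
  same-copy e =
    cong (if_then label H f (combine i e) else 0) (⌊⌋-⇔ (mk⇔ (proj₂ ∘ to) (from ∘ (refl ,_))) _ _)
    where open Equivalence (incident-copies k G i i v e)

VsumsInEveryCopy : ∀ k G → Labeling (copies k G) → (Fin (nV G) → ℕ) → Set
VsumsInEveryCopy k G f c = ∀ (i : Fin k) v → vsum (copies k G) f (combine i v) ≡ c v

copies-antimagic : ∀ k G f {c} → VsumsInEveryCopy k G f c → ProperColouring G c →
                   IsLocalAntimagic (copies k G) f
copies-antimagic k G f vsum≡c c-proper x eq =
  c-proper e (trans (sym (vsum≡c i _)) (trans eq (vsum≡c i _)))
  where
  i = proj₁ (remQuot {k} (nE G) x)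
  e = proj₂ (remQuot {k} (nE G) x)

copies-numColors≤length : ∀ k G f {c cs} → VsumsInEveryCopy k G f c → (∀ v → c v ∈ cs) →
                          numColors (copies k G) f ≤ length cs
copies-numColors≤length k G f {c} {cs} vsum≡c c∈cs = numColors≤length (copies k G) f vsum∈cs
  where
  vsum∈cs : ∀ w → vsum (copies k G) f w ∈ cs
  vsum∈cs w = subst (λ w → vsum (copies k G) f w ∈ cs) (combine-remQuot {k} (nV G) w)
                    (subst (_∈ cs) (sym (vsum≡c i v)) (c∈cs v))
    where
    i = proj₁ (remQuot {k} (nV G) w)
    v = proj₂ (remQuot {k} (nV G) w)

cast↔ : ∀ {m n} → m ≡ n → Fin m ↔ Fin n
cast↔ eq = mk↔ₛ′ (cast eq) (cast (sym eq)) (cast-involutive eq (sym eq)) (cast-involutive (sym eq) eq)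

twisted : ∀ {A B : Set} (τ : B → A → A) → (∀ b a → τ b (τ b a) ≡ a) → (A × B) ↔ (A × B)
twisted τ τ-involutive = mk↔ₛ′ twist twist involutive involutive
  where
  twist = λ (a , b) → τ b a , b
  involutive = λ (a , b) → cong (_, b) (τ-involutive b a)

regroup : ∀ {I E B S P : Set} → E ↔ (B × S) → (B → (I × S) ↔ P) → (I × E) ↔ (B × P)
regroup {I} {E} {B} {S} {P} E↔B×S layout = mk↔ₛ′ to′ from′ to∘from from∘to
  where
  open Inverse
  to′ : I × E → B × P
  to′ (i , e) = let (β , s) = to E↔B×S e in β , to (layout β) (i , s)
  from′ : B × P → I × E
  from′ (β , p) = let (i , s) = from (layout β) p in i , from E↔B×S (β , s)
  to∘from : ∀ q → to′ (from′ q) ≡ q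
  to∘from (β , p) rewrite strictlyInverseˡ E↔B×S (β , proj₂ (from (layout β) p)) =
    cong (β ,_) (strictlyInverseˡ (layout β) p)
  from∘to : ∀ q → from′ (to′ q) ≡ q
  from∘to (i , e) rewrite strictlyInverseʳ (layout (proj₁ (to E↔B×S e))) (i , proj₂ (to E↔B×S e)) =
    cong (i ,_) (strictlyInverseʳ E↔B×S e)

edgeSlot : Fin 10 → Fin 5 × Fin 2
edgeSlot 0F = 0F , 1F
edgeSlot 1F = 1F , 0F
edgeSlot 2F = 2F , 1F
edgeSlot 3F = 3F , 1F
edgeSlot 4F = 0F , 0F
edgeSlot 5F = 2F , 0F
edgeSlot 6F = 1F , 1F
edgeSlot 7F = 3F , 0F
edgeSlot 8F = 4F , 1F
edgeSlot 9F = 4F , 0F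

slotEdge : Fin 5 × Fin 2 → Fin 10
slotEdge (0F , 0F) = 4F
slotEdge (0F , 1F) = 0F
slotEdge (1F , 0F) = 1F
slotEdge (1F , 1F) = 6F
slotEdge (2F , 0F) = 5F
slotEdge (2F , 1F) = 2F
slotEdge (3F , 0F) = 7F
slotEdge (3F , 1F) = 3F
slotEdge (4F , 0F) = 9F
slotEdge (4F , 1F) = 8F

edges↔slots : Fin 10 ↔ (Fin 5 × Fin 2)
edges↔slots = mk↔ₛ′ edgeSlot slotEdge
  (λ (β , δ) → from-yes (all? λ β → all? λ δ → edgeSlot (slotEdge (β , δ)) ≟₂ (β , δ)) β δ)
  (from-yes (all? λ e → slotEdge (edgeSlot e) ≟ e))
  where _≟₂_ = ≡-dec _≟_ _≟_

sideTwist : ∀ {k} → Fin 2 → Fin k → Fin k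
sideTwist 0F i = i
sideTwist 1F i = opposite i

sideTwist-involutive : ∀ {k} δ (i : Fin k) → sideTwist δ (sideTwist δ i) ≡ i
sideTwist-involutive 0F i = refl
sideTwist-involutive 1F i = opposite-involutive i

halves : ∀ k → (Fin k × Fin 2) ↔ Fin (2 * k)
halves k = ↔-trans (×-comm (Fin k) (Fin 2)) (↔-sym *↔×)

interleaving : ∀ k → (Fin k × Fin 2) ↔ Fin (2 * k)
interleaving k = ↔-trans (↔-sym *↔×) (cast↔ (*-comm k 2))

blockLayout : ∀ k → Fin 5 → (Fin k × Fin 2) ↔ Fin (2 * k)
blockLayout k 1F = interleaving k
blockLayout k 2F = ↔-trans (twisted (λ _ → opposite) (λ _ → opposite-involutive)) (interleaving k)
blockLayout k _  = ↔-trans (twisted sideTwist sideTwist-involutive) (halves k)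

sideℕ : ℕ → ℕ → Fin 2 → ℕ
sideℕ a o 0F = a
sideℕ a o 1F = o

positionℕ : (k a o : ℕ) → Fin 5 → Fin 2 → ℕ
positionℕ k a o 1F δ = 2 * a + toℕ δ
positionℕ k a o 2F δ = 2 * o + toℕ δ
positionℕ k a o _  δ = k * toℕ δ + sideℕ a o δ

toℕ-halves : ∀ {k} δ (i : Fin k) →
             toℕ (combine δ (sideTwist δ i)) ≡ k * toℕ δ + sideℕ (toℕ i) (toℕ (opposite i)) δ
toℕ-halves 0F i = toℕ-combine {2} 0F i
toℕ-halves 1F i = toℕ-combine {2} 1F (opposite i)

toℕ-blockLayout : ∀ {k} β δ (i : Fin k) →
                  toℕ (Inverse.to (blockLayout k β) (i , δ)) ≡ positionℕ k (toℕ i) (toℕ (opposite i)) β δ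
toℕ-blockLayout 1F δ i = trans (toℕ-cast _ _) (toℕ-combine i δ)
toℕ-blockLayout 2F δ i = trans (toℕ-cast _ _) (toℕ-combine (opposite i) δ)
toℕ-blockLayout 0F δ i = toℕ-halves δ i
toℕ-blockLayout 3F δ i = toℕ-halves δ i
toℕ-blockLayout 4F δ i = toℕ-halves δ i

five-blocks : ∀ k → 5 * (2 * k) ≡ k * 10
five-blocks k = trans (sym (*-assoc 5 2 k)) (*-comm 10 k)

labellingD82↔ : ∀ k → Fin (k * 10) ↔ Fin (k * 10)
labellingD82↔ k =
  Fin (k * 10)           ↔⟨ *↔× ⟩
  (Fin k × Fin 10)       ↔⟨ regroup edges↔slots (blockLayout k) ⟩
  (Fin 5 × Fin (2 * k))  ↔⟨ ↔-sym *↔× ⟩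
  Fin (5 * (2 * k))      ↔⟨ cast↔ (five-blocks k) ⟩
  Fin (k * 10)           ∎
  where open EquationalReasoning

labellingD82 : ∀ k → Labeling (copies k D82)
labellingD82 k = Inverse.to (labellingD82↔ k) , Bijection.bijective (↔⇒⤖ (labellingD82↔ k))

labelValue : (k a o : ℕ) → Fin 10 → ℕ
labelValue k a o e = let (β , δ) = edgeSlot e in 2 * k * toℕ β + positionℕ k a o β δ

toℕ-labellingD82 : ∀ {k} (i : Fin k) e →
                   toℕ (proj₁ (labellingD82 k) (combine i e)) ≡ labelValue k (toℕ i) (toℕ (opposite i)) e
toℕ-labellingD82 {k} i e = begin
  toℕ (proj₁ (labellingD82 k) (combine i e))
    ≡⟨ cong (toℕ ∘ cast (five-blocks k) ∘ uncurry combine ∘ to (regroup edges↔slots (blockLayout k)))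
            (remQuot-combine i e) ⟩
  toℕ (cast (five-blocks k) (combine β t))   ≡⟨ toℕ-cast (five-blocks k) (combine β t) ⟩
  toℕ (combine β t)                          ≡⟨ toℕ-combine β t ⟩
  2 * k * toℕ β + toℕ t                      ≡⟨ cong (2 * k * toℕ β +_) (toℕ-blockLayout β δ i) ⟩
  labelValue k (toℕ i) (toℕ (opposite i)) e  ∎
  where
  open ≡-Reasoning
  open Inverse
  β = proj₁ (edgeSlot e)
  δ = proj₂ (edgeSlot e)
  t = to (blockLayout k β) (i , δ)

vertexClass : Fin 7 → Fin 3
vertexClass 1F = 1F
vertexClass 4F = 1F
vertexClass 6F = 2F
vertexClass _  = 0F

vertexClass-proper : ProperColouring D82 vertexClass
vertexClass-proper =
  from-yes (all? λ e → ¬? (vertexClass (proj₁ (ends D82 e)) ≟ vertexClass (proj₂ (ends D82 e))))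

colourValue : ℕ → Fin 3 → ℕ
colourValue k 0F = 8 * k + 1
colourValue k 1F = 14 * k + 1
colourValue k 2F = 40 * k + 4

colourValue-0<1 : ∀ k .{{_ : NonZero k}} → colourValue k 0F < colourValue k 1F
colourValue-0<1 k = +-monoˡ-< 1 (*-monoˡ-< k (from-yes (8 <? 14)))

colourValue-1<2 : ∀ k .{{_ : NonZero k}} → colourValue k 1F < colourValue k 2F
colourValue-1<2 k = +-mono-< (*-monoˡ-< k (from-yes (14 <? 40))) (from-yes (1 <? 4))

colourValue-0<2 : ∀ k .{{_ : NonZero k}} → colourValue k 0F < colourValue k 2F
colourValue-0<2 k = <-trans (colourValue-0<1 k) (colourValue-1<2 k)

colourValue-injective : ∀ k .{{_ : NonZero k}} → Injective _≡_ _≡_ (colourValue k)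
colourValue-injective k {0F} {0F} _  = refl
colourValue-injective k {0F} {1F} eq = contradiction eq (<⇒≢ (colourValue-0<1 k))
colourValue-injective k {0F} {2F} eq = contradiction eq (<⇒≢ (colourValue-0<2 k))
colourValue-injective k {1F} {0F} eq = contradiction (sym eq) (<⇒≢ (colourValue-0<1 k))
colourValue-injective k {1F} {1F} _  = refl
colourValue-injective k {1F} {2F} eq = contradiction eq (<⇒≢ (colourValue-1<2 k))
colourValue-injective k {2F} {0F} eq = contradiction (sym eq) (<⇒≢ (colourValue-0<2 k))
colourValue-injective k {2F} {1F} eq = contradiction (sym eq) (<⇒≢ (colourValue-1<2 k))
colourValue-injective k {2F} {2F} _  = refl

-- The vertex sums of one copy, with every label 1 + labelValue k a o e written in exactly the form it
-- unfolds to, so that they are the clauses of incidenceSum-labelValue up to definitional equality.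
sum-u₁ : ∀ a o → let k = 1 + a + o in
  1 + (2 * k * 0 + (k * 1 + o)) + (1 + (2 * k * 3 + (k * 0 + a)) + 0)
  ≡ 8 * k + 1
sum-u₁ = solve-∀

sum-u₂ : ∀ a o → let k = 1 + a + o in
  1 + (2 * k * 0 + (k * 1 + o)) + (1 + (2 * k * 1 + (2 * a + 0)) + (1 + (2 * k * 4 + (k * 1 + o)) + 0))
  ≡ 14 * k + 1
sum-u₂ = solve-∀

sum-u₃ : ∀ a o → let k = 1 + a + o in
  1 + (2 * k * 1 + (2 * a + 0)) + (1 + (2 * k * 2 + (2 * o + 1)) + 0)
  ≡ 8 * k + 1
sum-u₃ = solve-∀

sum-u₅ : ∀ a o → let k = 1 + a + o in
  1 + (2 * k * 3 + (k * 1 + o)) + (1 + (2 * k * 0 + (k * 0 + a)) + 0)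
  ≡ 8 * k + 1
sum-u₅ = solve-∀

sum-u₆ : ∀ a o → let k = 1 + a + o in
  1 + (2 * k * 0 + (k * 0 + a)) + (1 + (2 * k * 2 + (2 * o + 0)) + (1 + (2 * k * 4 + (k * 0 + a)) + 0))
  ≡ 14 * k + 1
sum-u₆ = solve-∀

sum-u₇ : ∀ a o → let k = 1 + a + o in
  1 + (2 * k * 2 + (2 * o + 0)) + (1 + (2 * k * 1 + (2 * a + 1)) + 0)
  ≡ 8 * k + 1
sum-u₇ = solve-∀

sum-w : ∀ a o → let k = 1 + a + o in
  1 + (2 * k * 2 + (2 * o + 1)) + (1 + (2 * k * 3 + (k * 1 + o)) + (1 + (2 * k * 1 + (2 * a + 1)) +
  (1 + (2 * k * 3 + (k * 0 + a)) + (1 + (2 * k * 4 + (k * 1 + o)) + (1 + (2 * k * 4 + (k * 0 + a)) + 0)))))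
  ≡ 40 * k + 4
sum-w = solve-∀

incidenceSum-labelValue : ∀ a o u → let k = 1 + a + o in
                          incidenceSum D82 (λ e → 1 + labelValue k a o e) u ≡ colourValue k (vertexClass u)
incidenceSum-labelValue a o 0F = sum-u₁ a o
incidenceSum-labelValue a o 1F = sum-u₂ a o
incidenceSum-labelValue a o 2F = sum-u₃ a o
incidenceSum-labelValue a o 3F = sum-u₅ a o
incidenceSum-labelValue a o 4F = sum-u₆ a o
incidenceSum-labelValue a o 5F = sum-u₇ a o
incidenceSum-labelValue a o 6F = sum-w a o

toℕ+toℕ-opposite : ∀ {k} (i : Fin k) → 1 + toℕ i + toℕ (opposite i) ≡ k
toℕ+toℕ-opposite {k} i = begin
  1 + toℕ i + toℕ (opposite i)   ≡⟨ cong (1 + toℕ i +_) (opposite-prop i) ⟩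
  1 + toℕ i + (k ∸ (1 + toℕ i))  ≡⟨ m+[n∸m]≡n (toℕ<n i) ⟩
  k                              ∎
  where open ≡-Reasoning

vsums-labellingD82 : ∀ k → VsumsInEveryCopy k D82 (labellingD82 k) (colourValue k ∘ vertexClass)
vsums-labellingD82 k i u = begin
  vsum (copies k D82) (labellingD82 k) (combine i u)
    ≡⟨ vsum-copies k D82 (labellingD82 k) i u ⟩
  incidenceSum D82 (λ e → label (copies k D82) (labellingD82 k) (combine i e)) u
    ≡⟨ incidenceSum-cong D82 (λ e → cong ℕ.suc (toℕ-labellingD82 i e)) u ⟩
  incidenceSum D82 (λ e → 1 + labelValue k a o e) u
    ≡⟨ subst (λ k → incidenceSum D82 (λ e → 1 + labelValue k a o e) u ≡ colourValue k (vertexClass u))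
             (toℕ+toℕ-opposite i) (incidenceSum-labelValue a o u) ⟩
  colourValue k (vertexClass u)
    ∎
  where
  open ≡-Reasoning
  a = toℕ i
  o = toℕ (opposite i)

copiesD82-3≤numColors : ∀ n f → IsLocalAntimagic (copies (ℕ.suc n) D82) f →
                        3 ≤ numColors (copies (ℕ.suc n) D82) f
copiesD82-3≤numColors n f antimagic = triangle⇒3≤numColors _ f antimagic
  (in-copy (0F , inj₁ refl)) (in-copy (8F , inj₂ refl)) (in-copy (7F , inj₂ refl))
  where in-copy = adjacent-copies (ℕ.suc n) D82 zero

theorem4p5 : (k : ℕ) → 1 ≤ k → ChiLaEq (copies k D82) 3
theorem4p5 (ℕ.suc n) _ = (f , antimagic , ≤-antisym atMost3 (copiesD82-3≤numColors n f antimagic))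
                       , copiesD82-3≤numColors n
  where
  k = ℕ.suc n
  f = labellingD82 k
  antimagic : IsLocalAntimagic (copies k D82) f
  antimagic = copies-antimagic k D82 f (vsums-labellingD82 k)
                (λ e → vertexClass-proper e ∘ colourValue-injective k)
  atMost3 : numColors (copies k D82) f ≤ 3
  atMost3 = copies-numColors≤length k D82 f (vsums-labellingD82 k)
              (λ u → ∈-map⁺ (colourValue k) (∈-allFin (vertexClass u)))
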